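{- Let $n\geq 3$ be an integer, and run the following recursive search procedure for $n$, starting from the triple $(p,s,i)=(1,0,0)$ and the empty candidate sequence. The procedure, called with a triple $(p,s,i)$ and a current candidate $(a_1,\dots,a_i)$, does the following: let $m:=a_i$ if $i\geq 1$ and $m:=n$ if $i=0$; for each $a'=2,3,\dots,m$ in increasing order, set $a_{i+1}:=a'$, $s':=s+a'$, $p':=p\cdot a'$, and then: if $p'>s'+n-(i+1)$, discard this choice and continue with the next $a'$; if $p'=s'+n-(i+1)$, record the sequence $(a_1,\dots,a_i,a_{i+1},1,\dots,1)$ of length $n$ (with $n-i-1$ trailing ones) as a solution and continue with the next $a'$; otherwise (i.e. $p'<s'+n-(i+1)$) call the procedure recursively with $(p',s',i+1)$ and candidate $(a_1,\dots,a_{i+1})$, and after it returns continue with the next $a'$. After all values of $a'$ have been tried, the call returns. Then the procedure records every non-increasing sequence $(a_1,\dots,a_n)$ of positive integers with $a_1\geq a_2\geq\dots\geq a_n$ satisfying $\prod_{i=1}^n a_i=\sum_{i=1}^n a_i$, and the last solution it records is the basic solution $(n,2,1,\dots,1)$.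
   Context: All sequences are of positive integers and are taken non-increasing, $a_1\geq a_2\geq\cdots$. The basic solution of length $n$ is $a_1=n$, $a_2=2$, $a_3=\dots=a_n=1$, which always satisfies $\prod_{i=1}^n a_i=\sum_{i=1}^n a_i$. -}

module Defs where

open import Data.Nat using (ℕ; zero; suc; _+_; _*_; _∸_; _≤_; _<_; _>_)
open import Data.List using (List; []; _∷_; _++_; [_]; replicate)
open import Relation.Binary.PropositionalEquality using (_≡_)

-- Target value s' + n - (i+1) (in ℕ; it is always ≥ 0 since s' ≥ 2(i+1)).
target : ℕ → ℕ → ℕ → ℕ
target n s′ i′ = (s′ + n) ∸ i′

-- Loop n p s i cand a m out
-- means: inside the call with triple (p,s,i) and current candidate
-- cand = (a_1,…,a_i), trying the values a' = a, a+1, …, m in increasing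
-- order finishes, and the solutions recorded during this part of the run
-- are, in recording order, the list out.
data Loop (n : ℕ) : ℕ → ℕ → ℕ → List ℕ → ℕ → ℕ → List (List ℕ) → Set where
  finish  : ∀ {p s i cand a m} → m < a → Loop n p s i cand a m []
  discard : ∀ {p s i cand a m out} → a ≤ m →
            p * a > target n (s + a) (suc i) →
            Loop n p s i cand (suc a) m out →
            Loop n p s i cand a m out
  record′ : ∀ {p s i cand a m out} → a ≤ m →
            p * a ≡ target n (s + a) (suc i) →
            Loop n p s i cand (suc a) m out →
            Loop n p s i cand a m
              (((cand ++ [ a ]) ++ replicate (n ∸ suc i) 1) ∷ out)
  recurse : ∀ {p s i cand a m out₁ out₂} → a ≤ m →
            p * a < target n (s + a) (suc i) →
            Loop n (p * a) (s + a) (suc i) (cand ++ [ a ]) 2 a out₁ →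
            Loop n p s i cand (suc a) m out₂ →
            Loop n p s i cand a m (out₁ ++ out₂)

-- The whole run for n: initial call with (p,s,i) = (1,0,0), empty
-- candidate; since i = 0, m = n.  `Search n out` says the run terminates
-- and records exactly the list out of solutions, in order.
Search : ℕ → List (List ℕ) → Set
Search n out = Loop n 1 0 0 [] 2 n out

basic : ℕ → List ℕ
basic n = n ∷ 2 ∷ replicate (n ∸ 2) 1

-- Write a solution as its entries ≥ 2 followed by ones.  Choosing its next entry b moves the
-- search from the state (p, s, i) of the entries before b to (pb, s + b, i + 1), and since
-- P·Πt + |t| ≥ P + Σt for P ≥ 1 and entries t ≥ 1 (strictly if P ≥ 2 and t starts with an
-- entry ≥ 2), the solution equation forces pb ≤ s + b + n − (i + 1), with equality exactly
-- when b is the last entry ≥ 2.  So the search never discards a prefix of a solution: it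
-- recurses on it until it records it.  It terminates because s + n − 2p − i decreases along
-- recursive calls, and the last value it tries at the top level, a₁ = n, produces only the
-- basic solution.
module Submission where

open import Defs
open import Data.Nat using (ℕ; _≤_; _<_; _≥_)
open import Data.List using (List; length; last)
open import Data.Nat.ListAction using (sum; product)
open import Data.List.Relation.Unary.All using (All)
open import Data.List.Relation.Unary.Linked using (Linked)
open import Data.List.Membership.Propositional using (_∈_)
open import Data.Maybe using (just)
open import Data.Product using (Σ; _×_)
open import Relation.Binary.PropositionalEquality using (_≡_)

open import Data.Nat using (zero; suc; _+_; _*_; _∸_; z≤n; s≤s; s≤s⁻¹)
open import Data.Nat.Properties
open import Data.Nat.Tactic.RingSolver using (solve-∀)
open import Data.Nat.ListAction.Properties using (sum-++; product-++)
open import Data.List using ([]; _∷_; _++_; [_]; _∷ʳ_; replicate)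
open import Data.List.Properties using (++-assoc; length-++; length-replicate)
open import Data.List.Relation.Unary.All using ([]; _∷_)
import Data.List.Relation.Unary.All as All
open import Data.List.Relation.Unary.Linked using ([]; [-]; _∷_)
import Data.List.Relation.Unary.Linked as Linked
open import Data.List.Relation.Unary.Any using (here; there)
open import Data.List.Membership.Propositional.Properties using (∈-++⁺ˡ; ∈-++⁺ʳ)
open import Data.Empty using (⊥-elim)
open import Data.Product using (_,_; ∃; ∃₂)
open import Data.Sum using (inj₁; inj₂)
open import Relation.Binary.PropositionalEquality using (_≢_; refl; sym; trans; cong; subst; module ≡-Reasoning)
open import Relation.Binary.Definitions using (tri<; tri≈; tri>)

variable
  n p s i a b m k f o x : ℕ
  t u cand : List ℕ
  out : List (List ℕ)

m+k≡n⇒m≤n : ∀ k → m + k ≡ n → m ≤ n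
m+k≡n⇒m≤n {m} k refl = m≤m+n m k

m+n≤m*n+1 : 1 ≤ m → 1 ≤ n → m + n ≤ m * n + 1
m+n≤m*n+1 {suc m} {suc n} _ _ = m+k≡n⇒m≤n (m * n) (identity m n)
  where
  identity : ∀ m n → suc m + suc n + m * n ≡ suc m * suc n + 1
  identity = solve-∀

m+n≤m*n : 2 ≤ m → 2 ≤ n → m + n ≤ m * n
m+n≤m*n {suc (suc m)} {suc (suc n)} (s≤s (s≤s _)) (s≤s (s≤s _)) = m+k≡n⇒m≤n (m + n + m * n) (identity m n)
  where
  identity : ∀ m n → suc (suc m) + suc (suc n) + (m + n + m * n) ≡ suc (suc m) * suc (suc n)
  identity = solve-∀

m+m+n≤m*n+2 : 1 ≤ m → 2 ≤ n → m + m + n ≤ m * n + 2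
m+m+n≤m*n+2 {suc m} {suc (suc n)} _ (s≤s (s≤s _)) = m+k≡n⇒m≤n (m * n) (identity m n)
  where
  identity : ∀ m n → suc m + suc m + suc (suc n) + m * n ≡ suc m * suc (suc n) + 2
  identity = solve-∀

m<o∸n⇒m+n<o : m < o ∸ n → m + n < o
m<o∸n⇒m+n<o {m = m} {o = o} {n = n} m<o∸n = m≤o∸n⇒m+n≤o (suc m) n≤o m<o∸n
  where
  n≤o : n ≤ o
  n≤o = <⇒≤ (m∸n≢0⇒n<m λ o∸n≡0 → n≮0 (subst (m <_) o∸n≡0 m<o∸n))

1≤product : All (1 ≤_) t → 1 ≤ product t
1≤product [] = ≤-refl
1≤product (1≤x ∷ 1≤t) = *-mono-≤ 1≤x (1≤product 1≤t)

+-sum≤*-product+length : 1 ≤ m → All (1 ≤_) t → m + sum t ≤ m * product t + length t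
+-sum≤*-product+length {m} {[]} _ [] = ≤-reflexive (cong (_+ 0) (sym (*-identityʳ m)))
+-sum≤*-product+length {m} {x ∷ t} 1≤m (1≤x ∷ 1≤t) = begin
  m + (x + sum t)                 ≡⟨ +-assoc m x (sum t) ⟨
  m + x + sum t                   ≤⟨ +-monoˡ-≤ (sum t) (m+n≤m*n+1 1≤m 1≤x) ⟩
  m * x + 1 + sum t               ≡⟨ +-shuffle (m * x) 1 (sum t) ⟩
  m * x + sum t + 1               ≤⟨ +-monoˡ-≤ 1 (+-sum≤*-product+length (*-mono-≤ 1≤m 1≤x) 1≤t) ⟩
  m * x * product t + length t + 1 ≡⟨ regroup m x (product t) (length t) ⟩
  m * (x * product t) + suc (length t) ∎
  where
  open ≤-Reasoning
  +-shuffle : ∀ a b c → a + b + c ≡ a + c + b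
  +-shuffle = solve-∀
  regroup : ∀ m x q l → m * x * q + l + 1 ≡ m * (x * q) + suc l
  regroup = solve-∀

+-sum<*-product+length : 2 ≤ m → 2 ≤ x → All (1 ≤_) t →
  m + sum (x ∷ t) < m * product (x ∷ t) + length (x ∷ t)
+-sum<*-product+length {m} {x} {t} 2≤m 2≤x 1≤t = begin-strict
  m + (x + sum t)                 ≡⟨ +-assoc m x (sum t) ⟨
  m + x + sum t                   ≤⟨ +-monoˡ-≤ (sum t) (m+n≤m*n 2≤m 2≤x) ⟩
  m * x + sum t                   ≤⟨ +-sum≤*-product+length (*-mono-≤ (<⇒≤ 2≤m) (<⇒≤ 2≤x)) 1≤t ⟩
  m * x * product t + length t    <⟨ n<1+n _ ⟩
  suc (m * x * product t + length t) ≡⟨ regroup m x (product t) (length t) ⟩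
  m * (x * product t) + suc (length t) ∎
  where
  open ≤-Reasoning
  regroup : ∀ m x q l → suc (m * x * q + l) ≡ m * (x * q) + suc l
  regroup = solve-∀

-- The state (p, s, i) extends by the entries t and n − i − |t| ones to a solution of
-- length n; the ones are carried to the left so that no subtraction occurs.
record Completes (n p s i : ℕ) (t : List ℕ) : Set where
  constructor completes
  field
    equation : p * product t + (length t + i) ≡ s + sum t + n

completes-∷ : Completes n p s i (b ∷ t) → Completes n (p * b) (s + b) (suc i) t
completes-∷ {n} {p} {s} {i} {b} {t} (completes equation) = completes (begin
  p * b * product t + (length t + suc i)     ≡⟨ lhs p b (product t) (length t) i ⟩
  p * (b * product t) + (suc (length t) + i) ≡⟨ equation ⟩
  s + (b + sum t) + n                        ≡⟨ rhs s b (sum t) n ⟩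
  s + b + sum t + n                          ∎)
  where
  open ≡-Reasoning
  lhs : ∀ p b q l i → p * b * q + (l + suc i) ≡ p * (b * q) + (suc l + i)
  lhs = solve-∀
  rhs : ∀ s b r n → s + (b + r) + n ≡ s + b + r + n
  rhs = solve-∀

completes-[] : Completes n p s i [] → p ≡ target n s i
completes-[] {n} {p} {s} {i} (completes equation) = begin
  p               ≡⟨ m+n∸n≡m p i ⟨
  (p + i) ∸ i     ≡⟨ cong (_∸ i) p+i≡s+n ⟩
  (s + n) ∸ i     ∎
  where
  open ≡-Reasoning
  p+i≡s+n : p + i ≡ s + n
  p+i≡s+n = trans (cong (_+ i) (sym (*-identityʳ p)))
                  (trans equation (cong (_+ n) (+-identityʳ s)))

completes⇒≤target : Completes n p s i t →
  k + (p + sum t) ≤ p * product t + length t → k + p ≤ target n s i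
completes⇒≤target {n} {p} {s} {i} {t} {k} (completes equation) bound =
  m+n≤o⇒m≤o∸n (k + p) (+-cancelʳ-≤ (sum t) (k + p + i) (s + n) (begin
    k + p + i + sum t                 ≡⟨ lhs k p i (sum t) ⟩
    k + (p + sum t) + i               ≤⟨ +-monoˡ-≤ i bound ⟩
    p * product t + length t + i      ≡⟨ +-assoc (p * product t) (length t) i ⟩
    p * product t + (length t + i)    ≡⟨ equation ⟩
    s + sum t + n                     ≡⟨ rhs s (sum t) n ⟩
    s + n + sum t                     ∎))
  where
  open ≤-Reasoning
  lhs : ∀ k p i r → k + p + i + r ≡ k + (p + r) + i
  lhs = solve-∀
  rhs : ∀ s r n → s + r + n ≡ s + n + r
  rhs = solve-∀

completes⇒≤ : 1 ≤ p → All (1 ≤_) t → Completes n p s i t → p ≤ target n s i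
completes⇒≤ 1≤p 1≤t sol =
  completes⇒≤target {k = 0} sol (+-sum≤*-product+length 1≤p 1≤t)

completes⇒< : 2 ≤ p → 2 ≤ x → All (1 ≤_) t → Completes n p s i (x ∷ t) → p < target n s i
completes⇒< 2≤p 2≤x 1≤t sol =
  completes⇒≤target {k = 1} sol (+-sum<*-product+length 2≤p 2≤x 1≤t)

-- A recursive call lowers s + n − 2p − i by (2p − 1)(a − 1) and is only possible while
-- that quantity is non-negative, so a fuel f with s + n < 2p + i + f bounds the depth.
recursion⇒fuel>0 : 1 ≤ p → 2 ≤ a → p * a < target n (s + a) (suc i) →
  s + n < p + p + i + f → 0 < f
recursion⇒fuel>0 {p} {a} {n} {s} {i} {f} 1≤p 2≤a recursion fuel =
  +-cancelˡ-≤ (p * a + 2 + i) 1 f (begin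
    p * a + 2 + i + 1          ≡⟨ lhs (p * a) i ⟩
    suc (suc (p * a + suc i))  ≤⟨ s≤s (m<o∸n⇒m+n<o recursion) ⟩
    suc (s + a + n)            ≡⟨ mid s a n ⟩
    suc (s + n) + a            ≤⟨ +-monoˡ-≤ a fuel ⟩
    p + p + i + f + a          ≡⟨ rhs p i f a ⟩
    p + p + a + (i + f)        ≤⟨ +-monoˡ-≤ (i + f) (m+m+n≤m*n+2 1≤p 2≤a) ⟩
    p * a + 2 + (i + f)        ≡⟨ +-assoc (p * a + 2) i f ⟨
    p * a + 2 + i + f          ∎)
  where
  open ≤-Reasoning
  lhs : ∀ q i → q + 2 + i + 1 ≡ suc (suc (q + suc i))
  lhs = solve-∀
  mid : ∀ s a n → suc (s + a + n) ≡ suc (s + n) + a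
  mid = solve-∀
  rhs : ∀ p i f a → p + p + i + f + a ≡ p + p + a + (i + f)
  rhs = solve-∀

recursion-fuel : 1 ≤ p → 2 ≤ a → s + n < p + p + i + suc f →
  s + a + n < p * a + p * a + suc i + f
recursion-fuel {p} {a} {s} {n} {i} {f} 1≤p 2≤a fuel = begin-strict
  s + a + n                  ≡⟨ lhs s a n ⟩
  s + n + a                  <⟨ +-monoˡ-≤ a fuel ⟩
  p + p + i + suc f + a      ≡⟨ mid p i f a ⟩
  p + p + a + suc (i + f)    ≤⟨ +-monoˡ-≤ (suc (i + f)) 2p+a≤2pa ⟩
  p * a + p * a + suc (i + f) ≡⟨ rhs (p * a) i f ⟩
  p * a + p * a + suc i + f  ∎
  where
  open ≤-Reasoning
  2p+a≤2pa : p + p + a ≤ p * a + p * a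
  2p+a≤2pa = ≤-trans (m+m+n≤m*n+2 1≤p 2≤a) (+-monoʳ-≤ (p * a) (*-mono-≤ 1≤p 2≤a))
  lhs : ∀ s a n → s + a + n ≡ s + n + a
  lhs = solve-∀
  mid : ∀ p i f a → p + p + i + suc f + a ≡ p + p + a + suc (i + f)
  mid = solve-∀
  rhs : ∀ q i f → q + q + suc (i + f) ≡ q + q + suc i + f
  rhs = solve-∀

loop-exists : ∀ f k → 1 ≤ p → 2 ≤ a → a + k ≡ suc m → s + n < p + p + i + f →
  ∃ (Loop n p s i cand a m)
loop-exists {a = a} f zero _ _ a+0≡1+m _ = [] , finish (≤-reflexive (trans (sym a+0≡1+m) (+-identityʳ a)))
loop-exists {p = p} {a = a} {s = s} {n = n} {i = i} f (suc k) 1≤p 2≤a a+1+k≡1+m fuel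
  with trans (sym (+-suc a k)) a+1+k≡1+m
... | 1+a+k≡1+m
  with s≤s⁻¹ (m+k≡n⇒m≤n k 1+a+k≡1+m)
     | loop-exists f k 1≤p (m≤n⇒m≤1+n 2≤a) 1+a+k≡1+m fuel
     | <-cmp (p * a) (target n (s + a) (suc i))
... | a≤m | out , rest | tri> _ _ overshoot = out , discard a≤m overshoot rest
... | a≤m | out , rest | tri≈ _ hit _ = _ , record′ a≤m hit rest
... | a≤m | out , rest | tri< recursion _ _ with f
...   | zero = ⊥-elim (<-irrefl refl (recursion⇒fuel>0 {n = n} {s = s} 1≤p 2≤a recursion fuel))
...   | suc f′ with loop-exists f′ (a ∸ 1) (*-mono-≤ 1≤p (<⇒≤ 2≤a)) ≤-refl
                      (cong suc (m+[n∸m]≡n (<⇒≤ 2≤a))) (recursion-fuel {s = s} {n = n} 1≤p 2≤a fuel)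
...     | inner-out , inner = inner-out ++ out , recurse a≤m recursion inner rest

search-exists : 1 ≤ n → ∃ (Search n)
search-exists {n} 1≤n =
  loop-exists n (n ∸ 1) ≤-refl ≤-refl (cong suc (m+[n∸m]≡n 1≤n)) (m<n⇒m<1+n (n<1+n n))

pad : ℕ → ℕ → List ℕ → List ℕ
pad n i xs = xs ++ replicate (n ∸ i) 1

pad-∷ʳ : pad n (length t + suc i) ((cand ++ [ a ]) ++ t) ≡ pad n (length (a ∷ t) + i) (cand ++ a ∷ t)
pad-∷ʳ {n} {t} {i} {cand} {a} =
  trans (cong (λ j → pad n j ((cand ++ [ a ]) ++ t)) (+-suc (length t) i))
        (cong (pad n (suc (length t + i))) (++-assoc cand [ a ] t))

loop-complete : Loop n p s i cand a m out → 1 ≤ p → a ≤ b → b ≤ m →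
  All (2 ≤_) (b ∷ t) → Linked _≥_ (b ∷ t) → Completes n p s i (b ∷ t) →
  pad n (length (b ∷ t) + i) (cand ++ b ∷ t) ∈ out
loop-complete (finish m<a) _ a≤b b≤m _ _ _ = ⊥-elim (<⇒≱ m<a (≤-trans a≤b b≤m))
loop-complete (discard _ overshoot rest) 1≤p a≤b b≤m 2≤bt@(2≤b ∷ 2≤t) sorted sol
  with m≤n⇒m<n∨m≡n a≤b
... | inj₁ a<b = loop-complete rest 1≤p a<b b≤m 2≤bt sorted sol
... | inj₂ refl = ⊥-elim (<⇒≱ overshoot
      (completes⇒≤ (*-mono-≤ 1≤p (<⇒≤ 2≤b)) (All.map <⇒≤ 2≤t) (completes-∷ sol)))
loop-complete (record′ _ hit rest) 1≤p a≤b b≤m 2≤bt sorted sol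
  with m≤n⇒m<n∨m≡n a≤b | 2≤bt
... | inj₁ a<b | _ = there (loop-complete rest 1≤p a<b b≤m 2≤bt sorted sol)
... | inj₂ refl | _ ∷ [] = here refl
... | inj₂ refl | 2≤b ∷ 2≤x ∷ 2≤t = ⊥-elim (<-irrefl hit
      (completes⇒< (*-mono-≤ 1≤p 2≤b) 2≤x (All.map <⇒≤ 2≤t) (completes-∷ sol)))
loop-complete {n = n} {i = i} {cand = cand} (recurse _ recursion inner rest) 1≤p a≤b b≤m 2≤bt sorted sol
  with m≤n⇒m<n∨m≡n a≤b | 2≤bt | sorted
... | inj₁ a<b | _ | _ = ∈-++⁺ʳ _ (loop-complete rest 1≤p a<b b≤m 2≤bt sorted sol)
... | inj₂ refl | _ ∷ [] | _ = ⊥-elim (<-irrefl (completes-[] (completes-∷ sol)) recursion)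
... | inj₂ refl | 2≤b ∷ 2≤xt@(2≤x ∷ _) | x≤b ∷ sorted′ =
  ∈-++⁺ˡ (subst (_∈ _) (pad-∷ʳ {n = n} {i = i} {cand = cand})
      (loop-complete inner (*-mono-≤ 1≤p (<⇒≤ 2≤b)) 2≤x x≤b 2≤xt sorted′ (completes-∷ sol)))

loop-overshooting : (∀ {b} → a ≤ b → b ≤ m → target n (s + b) (suc i) < p * b) →
  Loop n p s i cand a m out → out ≡ []
loop-overshooting _ (finish _) = refl
loop-overshooting overshoots (discard _ _ rest) =
  loop-overshooting (λ a<b → overshoots (<⇒≤ a<b)) rest
loop-overshooting overshoots (record′ a≤m hit _) = ⊥-elim (<-irrefl (sym hit) (overshoots ≤-refl a≤m))
loop-overshooting overshoots (recurse a≤m recursion _ _) = ⊥-elim (<-asym recursion (overshoots ≤-refl a≤m))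

top-recursion : 3 ≤ n → 1 * n < target n (0 + n) 1
top-recursion {suc (suc (suc n))} (s≤s (s≤s (s≤s _))) = m+k≡n⇒m≤n (suc n) (identity n)
  where
  identity : ∀ n → suc (1 * (3 + n)) + suc n ≡ suc (suc n) + suc (suc (suc n))
  identity = solve-∀

basic-hit : 2 ≤ n → 1 * n * 2 ≡ target n (0 + n + 2) 2
basic-hit {suc (suc n)} (s≤s (s≤s _)) = identity n
  where
  identity : ∀ n → 1 * suc (suc n) * 2 ≡ n + 2 + suc (suc n)
  identity = solve-∀

basic-overshoot : 2 ≤ n → 3 ≤ b → target n (0 + n + b) 2 < 1 * n * b
basic-overshoot {suc (suc n)} {suc (suc (suc b))} (s≤s (s≤s _)) (s≤s (s≤s (s≤s _))) =
  m+k≡n⇒m≤n (n + b + n * b) (identity n b)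
  where
  identity : ∀ n b → suc (n + (3 + b) + suc (suc n)) + (n + b + n * b) ≡ 1 * suc (suc n) * (3 + b)
  identity = solve-∀

basic-run : 2 ≤ n → Loop n (1 * n) (0 + n) 1 [ n ] 2 n out → out ≡ [ basic n ]
basic-run 2≤n (finish n<2) = ⊥-elim (<⇒≱ n<2 2≤n)
basic-run 2≤n (discard _ overshoot _) = ⊥-elim (<-irrefl (sym (basic-hit 2≤n)) overshoot)
basic-run 2≤n (record′ _ _ rest) =
  cong (_ ∷_) (loop-overshooting (λ 3≤b _ → basic-overshoot 2≤n 3≤b) rest)
basic-run 2≤n (recurse _ recursion _ _) = ⊥-elim (<-irrefl (basic-hit 2≤n) recursion)

run-ends-with-basic : 3 ≤ n → a ≤ n → Loop n 1 0 0 [] a n out → ∃ λ xs → out ≡ xs ∷ʳ basic n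
run-ends-with-basic _ a≤n (finish n<a) = ⊥-elim (<⇒≱ n<a a≤n)
run-ends-with-basic 3≤n a≤n (discard _ overshoot rest) with m≤n⇒m<n∨m≡n a≤n
... | inj₁ a<n = run-ends-with-basic 3≤n a<n rest
... | inj₂ refl = ⊥-elim (<-asym overshoot (top-recursion 3≤n))
run-ends-with-basic 3≤n a≤n (record′ _ hit rest) with m≤n⇒m<n∨m≡n a≤n
... | inj₁ a<n = let xs , ends = run-ends-with-basic 3≤n a<n rest in _ ∷ xs , cong (_ ∷_) ends
... | inj₂ refl = ⊥-elim (<-irrefl hit (top-recursion 3≤n))
run-ends-with-basic 3≤n a≤n (recurse {out₁ = out₁} _ _ inner rest) with m≤n⇒m<n∨m≡n a≤n
... | inj₁ a<n = let xs , ends = run-ends-with-basic 3≤n a<n rest in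
  out₁ ++ xs , trans (cong (out₁ ++_) ends) (sym (++-assoc out₁ xs _))
... | inj₂ refl
  rewrite basic-run (≤-trans (n≤1+n 2) 3≤n) inner
        | loop-overshooting (λ n<b b≤n → ⊥-elim (<⇒≱ n<b b≤n)) rest
  = [] , refl

last-∷ʳ : (xs : List (List ℕ)) → last (xs ∷ʳ t) ≡ just t
last-∷ʳ [] = refl
last-∷ʳ (_ ∷ []) = refl
last-∷ʳ (_ ∷ y ∷ ys) = last-∷ʳ (y ∷ ys)

head≤size : 1 ≤ b → 2 ≤ x → All (1 ≤_) t → Completes n 1 0 0 (b ∷ x ∷ t) → b ≤ n
head≤size {b} {x} {t} {n} 1≤b 2≤x 1≤t sol =
  +-cancelˡ-≤ (b + Q + (L + 1)) b n (begin
    b + Q + (L + 1) + b          ≡⟨ lhs b Q L ⟩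
    b + b + Q + (L + 1)          ≤⟨ +-monoˡ-≤ (L + 1) (m+m+n≤m*n+2 1≤b 2≤Q) ⟩
    b * Q + 2 + (L + 1)          ≡⟨ mid b Q L ⟩
    1 * b * Q + (L + 1) + 2      ≡⟨ cong (_+ 2) (Completes.equation (completes-∷ sol)) ⟩
    0 + b + S + n + 2            ≡⟨ rhs b S n ⟩
    b + n + 1 + (1 + S)          ≤⟨ +-monoʳ-≤ (b + n + 1) (+-sum≤*-product+length ≤-refl (<⇒≤ 2≤x ∷ 1≤t)) ⟩
    b + n + 1 + (1 * Q + L)      ≡⟨ end b Q L n ⟩
    b + Q + (L + 1) + n          ∎)
  where
  open ≤-Reasoning
  Q = product (x ∷ t)
  L = length (x ∷ t)
  S = sum (x ∷ t)
  2≤Q : 2 ≤ Q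
  2≤Q = *-mono-≤ 2≤x (1≤product 1≤t)
  lhs : ∀ b Q L → b + Q + (L + 1) + b ≡ b + b + Q + (L + 1)
  lhs = solve-∀
  mid : ∀ b Q L → b * Q + 2 + (L + 1) ≡ 1 * b * Q + (L + 1) + 2
  mid = solve-∀
  rhs : ∀ b S n → 0 + b + S + n + 2 ≡ b + n + 1 + (1 + S)
  rhs = solve-∀
  end : ∀ b Q L n → b + n + 1 + (1 * Q + L) ≡ b + Q + (L + 1) + n
  end = solve-∀

3≤n⇒n≢1 : 3 ≤ n → n ≢ 1
3≤n⇒n≢1 (s≤s ()) refl

singleton-completes⇒n≡1 : Completes n 1 0 0 [ b ] → n ≡ 1
singleton-completes⇒n≡1 {n} {b} (completes equation) =
  +-cancelˡ-≡ b n 1 (trans (lhs b n) (trans (sym equation) (rhs b)))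
  where
  lhs : ∀ b n → b + n ≡ 0 + (b + 0) + n
  lhs = solve-∀
  rhs : ∀ b → 1 * (b * 1) + (1 + 0) ≡ b + 1
  rhs = solve-∀

search-complete : 3 ≤ n → Search n out → All (2 ≤_) t → Linked _≥_ t → Completes n 1 0 0 t →
  pad n (length t) t ∈ out
search-complete 3≤n _ [] _ (completes equation) = ⊥-elim (3≤n⇒n≢1 3≤n (sym equation))
search-complete 3≤n _ (_ ∷ []) _ sol = ⊥-elim (3≤n⇒n≢1 3≤n (singleton-completes⇒n≡1 sol))
search-complete {n = n} {out = out} {t = t} 3≤n run 2≤bt@(2≤b ∷ 2≤x ∷ 2≤t) sorted sol =
  subst (λ j → pad n j t ∈ out) (+-identityʳ (length t))
    (loop-complete run ≤-refl 2≤b (head≤size (<⇒≤ 2≤b) 2≤x (All.map <⇒≤ 2≤t) sol) 2≤bt sorted sol)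

ones-below-one : All (1 ≤_) t → Linked _≥_ (1 ∷ t) → t ≡ replicate (length t) 1
ones-below-one [] _ = refl
ones-below-one {suc zero ∷ t} (_ ∷ 1≤t) (_ ∷ sorted) = cong (1 ∷_) (ones-below-one 1≤t sorted)
ones-below-one {suc (suc _) ∷ _} _ (s≤s () ∷ _)

linked-∷-prefix : Linked _≥_ (x ∷ t ++ u) → Linked _≥_ t → Linked _≥_ (x ∷ t)
linked-∷-prefix {t = []} _ _ = [-]
linked-∷-prefix {t = _ ∷ _} (y≤x ∷ _) sorted = y≤x ∷ sorted

split-ones : (xs : List ℕ) → All (1 ≤_) xs → Linked _≥_ xs →
  ∃₂ λ t k → xs ≡ t ++ replicate k 1 × All (2 ≤_) t × Linked _≥_ t
split-ones [] _ _ = [] , 0 , refl , [] , []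
split-ones (suc zero ∷ xs) (_ ∷ 1≤xs) sorted =
  [] , suc (length xs) , cong (1 ∷_) (ones-below-one 1≤xs sorted) , [] , []
split-ones (suc (suc x) ∷ xs) (_ ∷ 1≤xs) sorted with split-ones xs 1≤xs (Linked.tail sorted)
... | t , k , refl , 2≤t , sorted-t =
  suc (suc x) ∷ t , k , refl , s≤s (s≤s z≤n) ∷ 2≤t , linked-∷-prefix sorted sorted-t

solution-completes : product (t ++ replicate k 1) ≡ sum (t ++ replicate k 1) →
  Completes (length t + k) 1 0 0 t
solution-completes {t} {k} solution = completes (begin
  1 * product t + (length t + 0)                  ≡⟨ lhs (product t) (length t) ⟩
  product t * 1 + length t                        ≡⟨ cong (λ q → product t * q + length t) (product-ones k) ⟨
  product t * product (replicate k 1) + length t  ≡⟨ cong (_+ length t) (product-++ t _) ⟨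
  product (t ++ replicate k 1) + length t         ≡⟨ cong (_+ length t) solution ⟩
  sum (t ++ replicate k 1) + length t             ≡⟨ cong (_+ length t) (sum-++ t _) ⟩
  sum t + sum (replicate k 1) + length t          ≡⟨ cong (λ r → sum t + r + length t) (sum-ones k) ⟩
  sum t + k + length t                            ≡⟨ rhs (sum t) k (length t) ⟩
  0 + sum t + (length t + k)                      ∎)
  where
  open ≡-Reasoning
  product-ones : ∀ k → product (replicate k 1) ≡ 1
  product-ones zero = refl
  product-ones (suc k) = trans (+-identityʳ _) (product-ones k)
  sum-ones : ∀ k → sum (replicate k 1) ≡ k
  sum-ones zero = refl
  sum-ones (suc k) = cong suc (sum-ones k)
  lhs : ∀ q l → 1 * q + (l + 0) ≡ q * 1 + l
  lhs = solve-∀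
  rhs : ∀ r k l → r + k + l ≡ 0 + r + (l + k)
  rhs = solve-∀

search-finds-solutions : 3 ≤ n → Search n out → (xs : List ℕ) → length xs ≡ n → All (1 ≤_) xs →
  Linked _≥_ xs → product xs ≡ sum xs → xs ∈ out
search-finds-solutions {out = out} 3≤n run xs refl 1≤xs sorted solution
  with split-ones xs 1≤xs sorted
... | t , k , refl , 2≤t , sorted-t
  rewrite length-++ t {replicate k 1} | length-replicate k {1} =
  subst (λ j → t ++ replicate j 1 ∈ out) (m+n∸m≡n (length t) k)
    (search-complete 3≤n run 2≤t sorted-t (solution-completes solution))

theorem2p2 : (n : ℕ) → 3 ≤ n →
    Σ (List (List ℕ)) (λ out →
      Search n out
      × ((as : List ℕ) → length as ≡ n → All (1 ≤_) as → Linked _≥_ as →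
           product as ≡ sum as → as ∈ out)
      × last out ≡ just (basic n))
theorem2p2 n 3≤n with search-exists (≤-trans (s≤s z≤n) 3≤n)
... | out , run with run-ends-with-basic 3≤n (≤-trans (n≤1+n 2) 3≤n) run
...   | xs , refl = xs ∷ʳ basic n , run , search-finds-solutions 3≤n run , last-∷ʳ xs
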